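{- Let $a, b, c$ be nonzero integers such that $-ab$ is not a perfect square and $\gcd(a,b,c)=1$, and let $X, Y \in M_2(\mathbb{Z})$. Then $aX^2 + bY^2 = cI$ and $XY = YX$ if and only if one of the following holds: (i) $X = t_1 I$ and $Y = t_2 I$, where $t_1, t_2 \in \mathbb{Z}$ satisfy $a t_1^2 + b t_2^2 = c$; (ii) $X = t_1 I$ and $Y = \begin{pmatrix} t_4 & t_2 \\ t_3 & -t_4 \end{pmatrix}$, where $t_1, t_2, t_3, t_4 \in \mathbb{Z}$ satisfy $a t_1^2 + b(t_4^2 + t_2 t_3) = c$; (iii) $X = \begin{pmatrix} t_1 & \frac{u-c}{g} t_2 \\ \frac{u-c}{g} t_3 & \frac{u t_1 + vb t_4}{c} \end{pmatrix}$ and $Y = \begin{pmatrix} t_4 & \frac{va}{g} t_2 \\ \frac{va}{g} t_3 & \frac{va t_1 - u t_4}{c} \end{pmatrix}$, where $t_1, t_2, t_3, t_4, u, v \in \mathbb{Z}$, $u \neq c$, $g = \gcd(va, u-c)$, and $$u^2 + v^2 ab = c^2, \quad a t_1^2 + b t_4^2 + \frac{2ac\, t_2 t_3}{g^2}(c-u) = c, \quad c \mid (u t_1 + vb t_4), \quad c \mid (va t_1 - u t_4).$$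
   Context: $M_2(\mathbb{Z})$ denotes the ring of $2\times 2$ matrices with integer entries; $I$ is the $2\times 2$ identity matrix. -}

module Defs where

open import Data.Integer using (ℤ; +_; -[1+_]; _+_; _-_; _*_; -_)
import Data.Integer.DivMod as DM
open import Data.Nat using (suc)
open import Relation.Binary.PropositionalEquality using (_≡_)

record M₂ : Set where
  constructor mat
  field
    m11 m12 m21 m22 : ℤ
open M₂ public

_·_ : M₂ → M₂ → M₂
mat a b c d · mat e f g h = mat (a * e + b * g) (a * f + b * h) (c * e + d * g) (c * f + d * h)

_⊕_ : M₂ → M₂ → M₂
mat a b c d ⊕ mat e f g h = mat (a + e) (b + f) (c + g) (d + h)

_⊙_ : ℤ → M₂ → M₂
k ⊙ mat a b c d = mat (k * a) (k * b) (k * c) (k * d)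

scal : ℤ → M₂
scal t = mat t (+ 0) (+ 0) t

I₂ : M₂
I₂ = scal (+ 1)

-- integer division n / d (Euclidean, from the stdlib); only used when d ≠ 0
-- and d ∣ n, where it is the exact quotient.  Junk value 0 for d = 0.
_÷_ : ℤ → ℤ → ℤ
n ÷ (+ 0) = + 0
n ÷ (+ (suc k)) = n DM./ (+ suc k)
n ÷ -[1+ k ] = n DM./ -[1+ k ]

-- Since X and Y commute, aX² + bY² = cI factors as Z W = cI with Z = √a X + √-b Y and
-- W = √a X - √-b Y.  Taking determinants, u = a det X - b det Y and the polarised
-- determinant v = x₁y₄ + x₄y₁ - 2x₂y₃ (commutation gives x₂y₃ = x₃y₂) satisfy
-- u² + abv² = c², and W = c Z⁻¹ yields the linear relations c x₄ = u x₁ + vb y₁,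
-- c y₄ = va x₁ - u y₁ and (u - c)(y₂, y₃) = va (x₂, x₃).
-- If X is scalar, bY² is scalar, so Y is scalar or traceless.  Otherwise u ≠ c, since
-- u = c forces X to be scalar, so the pairs (x₂, y₂) and (x₃, y₃) are integer multiples
-- t₂, t₃ of the primitive vector (u - c, va)/g, and the (1,1) entry of the equation
-- turns into the quadratic condition.

module Submission where

open import Defs
open import Data.Integer using (ℤ; +_; _+_; _-_; _*_; -_)
open import Data.Integer.Divisibility using (_∣_)
open import Data.Integer.GCD using (gcd)
open import Data.Product using (Σ; ∃; _×_; _,_)
open import Data.Sum using (_⊎_)
open import Relation.Nullary using (¬_)
open import Relation.Binary.PropositionalEquality using (_≡_; _≢_)
open import Function.Bundles using (_⇔_)

open import Data.Empty using (⊥-elim)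
open import Data.Integer using (-[1+_]; +[1+_]; NonZero; ≢-nonZero)
import Data.Integer as ℤ using (∣_∣)
open import Data.Integer.Coprimality using (Coprime; coprime-divisor)
import Data.Integer.Coprimality as Coprime
import Data.Integer.DivMod as DM
open import Data.Integer.Divisibility.Signed using (divides; ∣ᵤ⇒∣; ∣⇒∣ᵤ)
open import Data.Integer.GCD using (gcd[i,j]∣i; gcd[i,j]∣j; gcd[i,j]≡0⇒j≡0)
open import Data.Integer.Properties
  using (_≟_; i≡j⇒i-j≡0; i-j≡0⇒i≡j; i*j≡0⇒i≡0∨j≡0; *-zeroʳ; *-cancelˡ-≡; *-comm; abs-*; ∣i∣≡0⇒i≡0)
open import Data.Integer.Tactic.RingSolver using (solve)
open import Data.List using (List; _∷_; [])
import Data.Nat as ℕ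
import Data.Nat.Coprimality as ℕ
import Data.Nat.DivMod as ℕ
import Data.Nat.GCD as ℕ
import Data.Nat.Properties as ℕ
open import Data.Sum using (inj₁; inj₂; [_,_]′; map₂)
open import Function using (id; _∘_)
open import Function.Bundles using (Equivalence; mk⇔)
open import Relation.Nullary using (yes; no)
open import Relation.Nullary.Decidable using (_×-dec_)
open import Relation.Binary.PropositionalEquality using (refl; sym; trans; cong; subst₂)

*-≢0 : ∀ {i j} → i ≢ + 0 → j ≢ + 0 → i * j ≢ + 0
*-≢0 {i} i≢0 j≢0 ij≡0 = [ i≢0 , j≢0 ]′ (i*j≡0⇒i≡0∨j≡0 i ij≡0)

i*j≡0⇒j≡0 : ∀ {i j} → i ≢ + 0 → i * j ≡ + 0 → j ≡ + 0
i*j≡0⇒j≡0 {i} i≢0 ij≡0 = [ ⊥-elim ∘ i≢0 , id ]′ (i*j≡0⇒i≡0∨j≡0 i ij≡0)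

i*j≡0⇒i≡0 : ∀ {i j} → j ≢ + 0 → i * j ≡ + 0 → i ≡ + 0
i*j≡0⇒i≡0 {i} j≢0 ij≡0 = [ id , ⊥-elim ∘ j≢0 ]′ (i*j≡0⇒i≡0∨j≡0 i ij≡0)

k*x*x≡0⇒x≡0 : ∀ {k x} → k ≢ + 0 → k * x * x ≡ + 0 → x ≡ + 0
k*x*x≡0⇒x≡0 {k} {x} k≢0 kxx≡0 =
  [ i*j≡0⇒j≡0 k≢0 , id ]′ (i*j≡0⇒i≡0∨j≡0 (k * x) kxx≡0)

-- Certificates: l ≡ r follows from hypotheses lᵢ ≡ rᵢ once the ring solver checks
-- the polynomial identity l - r = k₁ * (l₁ - r₁) + … + kₙ * (lₙ - rₙ).

infixl 6 _⊞_
infix 7 _⊗_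

_⊗_ : ∀ (k : ℤ) {l r : ℤ} → l ≡ r → k * (l - r) ≡ + 0
k ⊗ l≡r = trans (cong (k *_) (i≡j⇒i-j≡0 l≡r)) (*-zeroʳ k)

_⊞_ : ∀ {i j} → i ≡ + 0 → j ≡ + 0 → i + j ≡ + 0
refl ⊞ refl = refl

by-certificate : ∀ {l r e} → e ≡ + 0 → l - r ≡ e → l ≡ r
by-certificate {l} {r} e≡0 l-r≡e = i-j≡0⇒i≡j l r (trans l-r≡e e≡0)

cancel-certificate : ∀ {n l r e} → n ≢ + 0 → e ≡ + 0 → n * (l - r) ≡ e → l ≡ r
cancel-certificate {n} {l} {r} n≢0 e≡0 n[l-r]≡e =
  i-j≡0⇒i≡j l r (i*j≡0⇒j≡0 n≢0 (trans n[l-r]≡e e≡0))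

[k-q]*d≡r : ∀ k q d {r} → k * d ≡ r + q * d → (k - q) * d ≡ r
[k-q]*d≡r k q d {r} eq = by-certificate (+ 1 ⊗ eq) (solve (k ∷ q ∷ d ∷ r ∷ []))

m*d≡r<∣d∣⇒m≡0 : ∀ m d {r} → m * d ≡ + r → r ℕ.< ℤ.∣ d ∣ → m ≡ + 0
m*d≡r<∣d∣⇒m≡0 m d {r} md≡r r<d = ∣i∣≡0⇒i≡0 (ℕ.n<1⇒n≡0
  (ℕ.*-cancelʳ-< ℤ.∣ d ∣ ℤ.∣ m ∣ 1 (subst₂ ℕ._<_ r≡∣m∣∣d∣ (sym (ℕ.*-identityˡ ℤ.∣ d ∣)) r<d)))
  where
  r≡∣m∣∣d∣ : r ≡ ℤ.∣ m ∣ ℕ.* ℤ.∣ d ∣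
  r≡∣m∣∣d∣ = trans (sym (cong ℤ.∣_∣ md≡r)) (abs-* m d)

i*j/j≡i : ∀ i j .{{_ : NonZero j}} → (i * j) DM./ j ≡ i
i*j/j≡i i j = sym (i-j≡0⇒i≡j i q (m*d≡r<∣d∣⇒m≡0 (i - q) j
  ([k-q]*d≡r i q j (DM.a≡a%n+[a/n]*n (i * j) j)) (DM.n%d<d (i * j) j)))
  where
  q : ℤ
  q = (i * j) DM./ j

i*j÷j≡i : ∀ i {j} → j ≢ + 0 → (i * j) ÷ j ≡ i
i*j÷j≡i i {+ 0}       j≢0 = ⊥-elim (j≢0 refl)
i*j÷j≡i i {+[1+ n ]}  _   = i*j/j≡i i +[1+ n ]
i*j÷j≡i i { -[1+ n ]} _   = i*j/j≡i i -[1+ n ]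

n≡[n÷d]*d : ∀ d {n} → d ≢ + 0 → d ∣ n → n ≡ (n ÷ d) * d
n≡[n÷d]*d d {n} d≢0 d∣n with ∣ᵤ⇒∣ {d} {n} d∣n
... | divides q refl = cong (_* d) (sym (i*j÷j≡i q d≢0))

d*q≡n⇒d∣n : ∀ d q {n} → d * q ≡ n → d ∣ n
d*q≡n⇒d∣n d q dq≡n = ∣⇒∣ᵤ (divides q (trans (sym dq≡n) (*-comm d q)))

coprime-÷gcd : ∀ i j → gcd i j ≢ + 0 → Coprime (i ÷ gcd i j) (j ÷ gcd i j)
coprime-÷gcd i j g≢0 = subst₂ ℕ.Coprime
  (∣n∣/gcd≡∣n÷gcd∣ (gcd[i,j]∣i i j)) (∣n∣/gcd≡∣n÷gcd∣ (gcd[i,j]∣j i j))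
  (ℕ.coprime-/gcd ℤ.∣ i ∣ ℤ.∣ j ∣)
  where
  instance
    gcd-nonZero : ℕ.NonZero (ℕ.gcd ℤ.∣ i ∣ ℤ.∣ j ∣)
    gcd-nonZero = ℕ.≢-nonZero (g≢0 ∘ cong (+_))
  ∣n∣/gcd≡∣n÷gcd∣ : ∀ {n} → gcd i j ∣ n → ℤ.∣ n ∣ ℕ./ ℕ.gcd ℤ.∣ i ∣ ℤ.∣ j ∣ ≡ ℤ.∣ n ÷ gcd i j ∣
  ∣n∣/gcd≡∣n÷gcd∣ {n} g∣n = trans
    (cong (ℕ._/ ℕ.gcd ℤ.∣ i ∣ ℤ.∣ j ∣)
      (trans (cong ℤ.∣_∣ (n≡[n÷d]*d (gcd i j) g≢0 g∣n)) (abs-* (n ÷ gcd i j) (gcd i j))))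
    (ℕ.m*n/n≡m ℤ.∣ n ÷ gcd i j ∣ (ℕ.gcd ℤ.∣ i ∣ ℤ.∣ j ∣))

coprime-proportional : ∀ {m n x y} → Coprime m n → m ≢ + 0 → m * y ≡ n * x →
  ∃ λ t → x ≡ m * t × y ≡ n * t
coprime-proportional {m} {n} {x} {y} coprime m≢0 my≡nx
  with ∣ᵤ⇒∣ {m} {x} (coprime-divisor m n x coprime (d*q≡n⇒d∣n m y my≡nx))
... | divides t refl = t , *-comm t m ,
  *-cancelˡ-≡ m y (n * t) {{≢-nonZero m≢0}} (trans my≡nx (solve (m ∷ n ∷ t ∷ [])))

*-cancelʳ-proportion : ∀ {g m n x y} → g ≢ + 0 → m * g * y ≡ n * g * x → m * y ≡ n * x
*-cancelʳ-proportion {g} {m} {n} {x} {y} g≢0 eq =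
  cancel-certificate g≢0 (+ 1 ⊗ eq) (solve (g ∷ m ∷ n ∷ x ∷ y ∷ []))

gcd≢0 : ∀ i {j} → j ≢ + 0 → gcd i j ≢ + 0
gcd≢0 i j≢0 = j≢0 ∘ gcd[i,j]≡0⇒j≡0 {i}

i≡[i÷gcd]*gcd : ∀ i {j} → j ≢ + 0 → i ≡ (i ÷ gcd i j) * gcd i j
i≡[i÷gcd]*gcd i {j} j≢0 = n≡[n÷d]*d (gcd i j) (gcd≢0 i j≢0) (gcd[i,j]∣i i j)

j≡[j÷gcd]*gcd : ∀ i {j} → j ≢ + 0 → j ≡ (j ÷ gcd i j) * gcd i j
j≡[j÷gcd]*gcd i {j} j≢0 = n≡[n÷d]*d (gcd i j) (gcd≢0 i j≢0) (gcd[i,j]∣j i j)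

gcd-proportional : ∀ i {j x y} → j ≢ + 0 → j * y ≡ i * x →
  ∃ λ t → x ≡ (j ÷ gcd i j) * t × y ≡ (i ÷ gcd i j) * t
gcd-proportional i {j} {x} {y} j≢0 jy≡ix =
  coprime-proportional {j ÷ gcd i j} {i ÷ gcd i j} coprime A≢0 Ay≡Bx
  where
  A≢0 : j ÷ gcd i j ≢ + 0
  A≢0 A≡0 = j≢0 (trans (j≡[j÷gcd]*gcd i j≢0) (cong (_* gcd i j) A≡0))
  coprime : Coprime (j ÷ gcd i j) (i ÷ gcd i j)
  coprime = Coprime.sym {i ÷ gcd i j} {j ÷ gcd i j} (coprime-÷gcd i j (gcd≢0 i j≢0))
  Ay≡Bx : (j ÷ gcd i j) * y ≡ (i ÷ gcd i j) * x
  Ay≡Bx = *-cancelʳ-proportion {gcd i j} {j ÷ gcd i j} {i ÷ gcd i j} {x} {y} (gcd≢0 i j≢0)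
    (subst₂ (λ j′ i′ → j′ * y ≡ i′ * x) (j≡[j÷gcd]*gcd i j≢0) (i≡[i÷gcd]*gcd i j≢0) jy≡ix)

d*q≡n⇒q≡n÷d : ∀ {d} q {n} → d ≢ + 0 → d * q ≡ n → q ≡ n ÷ d
d*q≡n⇒q≡n÷d {d} q d≢0 dq≡n =
  sym (trans (cong (_÷ d) (trans (sym dq≡n) (*-comm d q))) (i*j÷j≡i q d≢0))

mat-cong : ∀ {p q r s p′ q′ r′ s′} → p ≡ p′ → q ≡ q′ → r ≡ r′ → s ≡ s′ →
  mat p q r s ≡ mat p′ q′ r′ s′
mat-cong refl refl refl refl = refl

module _ (a b c : ℤ) where

  Solves : M₂ → M₂ → Set
  Solves X Y = ((a ⊙ (X · X)) ⊕ (b ⊙ (Y · Y)) ≡ c ⊙ I₂) × (X · Y ≡ Y · X)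

  record Entrywise (x₁ x₂ x₃ x₄ y₁ y₂ y₃ y₄ : ℤ) : Set where
    field
      square₁₁ : a * (x₁ * x₁ + x₂ * x₃) + b * (y₁ * y₁ + y₂ * y₃) ≡ c * + 1
      square₁₂ : a * (x₁ * x₂ + x₂ * x₄) + b * (y₁ * y₂ + y₂ * y₄) ≡ c * + 0
      square₂₁ : a * (x₃ * x₁ + x₄ * x₃) + b * (y₃ * y₁ + y₄ * y₃) ≡ c * + 0
      square₂₂ : a * (x₃ * x₂ + x₄ * x₄) + b * (y₃ * y₂ + y₄ * y₄) ≡ c * + 1
      commute₁₁ : x₁ * y₁ + x₂ * y₃ ≡ y₁ * x₁ + y₂ * x₃
      commute₁₂ : x₁ * y₂ + x₂ * y₄ ≡ y₁ * x₂ + y₂ * x₄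
      commute₂₁ : x₃ * y₁ + x₄ * y₃ ≡ y₃ * x₁ + y₄ * x₃
      commute₂₂ : x₃ * y₂ + x₄ * y₄ ≡ y₃ * x₂ + y₄ * x₄

  Solves⇔Entrywise : ∀ x₁ x₂ x₃ x₄ y₁ y₂ y₃ y₄ →
    Solves (mat x₁ x₂ x₃ x₄) (mat y₁ y₂ y₃ y₄) ⇔ Entrywise x₁ x₂ x₃ x₄ y₁ y₂ y₃ y₄
  Solves⇔Entrywise _ _ _ _ _ _ _ _ = mk⇔
    (λ (H , C) → record
      { square₁₁ = cong m11 H ; square₁₂ = cong m12 H
      ; square₂₁ = cong m21 H ; square₂₂ = cong m22 H
      ; commute₁₁ = cong m11 C ; commute₁₂ = cong m12 C
      ; commute₂₁ = cong m21 C ; commute₂₂ = cong m22 C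
      })
    (λ E → let open Entrywise E in
      mat-cong square₁₁ square₁₂ square₂₁ square₂₂ ,
      mat-cong commute₁₁ commute₁₂ commute₂₁ commute₂₂)

  ScalarPair : M₂ → M₂ → Set
  ScalarPair X Y = ∃ λ t₁ → ∃ λ t₂ → X ≡ scal t₁ × Y ≡ scal t₂
    × a * t₁ * t₁ + b * t₂ * t₂ ≡ c

  ScalarTraceless : M₂ → M₂ → Set
  ScalarTraceless X Y = ∃ λ t₁ → ∃ λ t₂ → ∃ λ t₃ → ∃ λ t₄ →
    X ≡ scal t₁ × Y ≡ mat t₄ t₂ t₃ (- t₄)
    × a * t₁ * t₁ + b * (t₄ * t₄ + t₂ * t₃) ≡ c

  ParametricPair : M₂ → M₂ → Set
  ParametricPair X Y = ∃ λ t₁ → ∃ λ t₂ → ∃ λ t₃ → ∃ λ t₄ → ∃ λ u → ∃ λ v →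
    let g = gcd (v * a) (u - c) in
    u ≢ c
    × u * u + v * v * (a * b) ≡ c * c
    × g * g * (a * t₁ * t₁ + b * t₄ * t₄ - c)
        + + 2 * a * c * t₂ * t₃ * (c - u) ≡ + 0
    × c ∣ (u * t₁ + v * b * t₄)
    × c ∣ (v * a * t₁ - u * t₄)
    × X ≡ mat t₁ (((u - c) ÷ g) * t₂) (((u - c) ÷ g) * t₃)
              ((u * t₁ + v * b * t₄) ÷ c)
    × Y ≡ mat t₄ (((v * a) ÷ g) * t₂) (((v * a) ÷ g) * t₃)
              ((v * a * t₁ - u * t₄) ÷ c)

  Classified : M₂ → M₂ → Set
  Classified X Y = ScalarPair X Y ⊎ ScalarTraceless X Y ⊎ ParametricPair X Y

  scalar-pair-solves : ∀ t₁ t₂ → a * t₁ * t₁ + b * t₂ * t₂ ≡ c →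
    Entrywise t₁ (+ 0) (+ 0) t₁ t₂ (+ 0) (+ 0) t₂
  scalar-pair-solves t₁ t₂ eq = record
    { square₁₁ = by-certificate (+ 1 ⊗ eq) (solve vars) ; square₁₂ = solve vars
    ; square₂₁ = solve vars ; square₂₂ = by-certificate (+ 1 ⊗ eq) (solve vars)
    ; commute₁₁ = solve vars ; commute₁₂ = solve vars
    ; commute₂₁ = solve vars ; commute₂₂ = solve vars
    }
    where
    vars : List ℤ
    vars = a ∷ b ∷ c ∷ t₁ ∷ t₂ ∷ []

  scalar-traceless-solves : ∀ t₁ t₂ t₃ t₄ → a * t₁ * t₁ + b * (t₄ * t₄ + t₂ * t₃) ≡ c →
    Entrywise t₁ (+ 0) (+ 0) t₁ t₄ t₂ t₃ (- t₄)
  scalar-traceless-solves t₁ t₂ t₃ t₄ eq = record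
    { square₁₁ = by-certificate (+ 1 ⊗ eq) (solve vars) ; square₁₂ = solve vars
    ; square₂₁ = solve vars ; square₂₂ = by-certificate (+ 1 ⊗ eq) (solve vars)
    ; commute₁₁ = solve vars ; commute₁₂ = solve vars
    ; commute₂₁ = solve vars ; commute₂₂ = solve vars
    }
    where
    vars : List ℤ
    vars = a ∷ b ∷ c ∷ t₁ ∷ t₂ ∷ t₃ ∷ t₄ ∷ []

  parametric-solves : ∀ u v t₁ t₂ t₃ t₄ A B g K₁ K₂ → c ≢ + 0 → g ≢ + 0 →
    u * u + v * v * (a * b) ≡ c * c →
    g * g * (a * t₁ * t₁ + b * t₄ * t₄ - c) + + 2 * a * c * t₂ * t₃ * (c - u) ≡ + 0 →
    u - c ≡ A * g → v * a ≡ B * g →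
    u * t₁ + v * b * t₄ ≡ K₁ * c → v * a * t₁ - u * t₄ ≡ K₂ * c →
    Entrywise t₁ (A * t₂) (A * t₃) K₁ t₄ (B * t₂) (B * t₃) K₂
  parametric-solves u v t₁ t₂ t₃ t₄ A B g K₁ K₂
    c≢0 g≢0 norm quad u-c≡Ag va≡Bg K₁-def K₂-def = record
    { square₁₁ = cancel-certificate g² (+ 1 ⊗ quad ⊞ (a * t₂ * t₃) ⊗ norm
        ⊞ (- (a * t₂ * t₃ * ((u - c) + A * g))) ⊗ u-c≡Ag
        ⊞ (- (b * t₂ * t₃ * (v * a + B * g))) ⊗ va≡Bg) (solve vars)
    ; square₁₂ = cancel-certificate gc ((- (a * c * t₂ * K₁) - a * c * t₁ * t₂) ⊗ u-c≡Ag
        ⊞ (- (b * c * t₂ * K₂) - b * c * t₂ * t₄) ⊗ va≡Bg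
        ⊞ (c * a * t₂ - a * u * t₂) ⊗ K₁-def ⊞ (- (a * b * v * t₂)) ⊗ K₂-def
        ⊞ (a * t₁ * t₂) ⊗ norm) (solve vars)
    ; square₂₁ = cancel-certificate gc ((- (a * c * t₃ * K₁) - a * c * t₁ * t₃) ⊗ u-c≡Ag
        ⊞ (- (b * c * t₃ * K₂) - b * c * t₃ * t₄) ⊗ va≡Bg
        ⊞ (c * a * t₃ - a * u * t₃) ⊗ K₁-def ⊞ (- (a * b * v * t₃)) ⊗ K₂-def
        ⊞ (a * t₁ * t₃) ⊗ norm) (solve vars)
    ; square₂₂ = cancel-certificate (*-≢0 (*-≢0 g² c≢0) c≢0) ((c * c) ⊗ quad
        ⊞ (c * c * a * t₂ * t₃ + g * g * (a * t₁ * t₁ + b * t₄ * t₄)) ⊗ norm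
        ⊞ (- (c * c * a * t₂ * t₃ * ((u - c) + A * g))) ⊗ u-c≡Ag
        ⊞ (- (c * c * b * t₂ * t₃ * (v * a + B * g))) ⊗ va≡Bg
        ⊞ (- (g * g * a * ((u * t₁ + v * b * t₄) + c * K₁))) ⊗ K₁-def
        ⊞ (- (g * g * b * ((v * a * t₁ - u * t₄) + c * K₂))) ⊗ K₂-def) (solve vars)
    ; commute₁₁ = solve vars
    ; commute₁₂ = cancel-certificate gc ((c * t₂ * t₄ - c * t₂ * K₂) ⊗ u-c≡Ag
        ⊞ (c * t₂ * K₁ - c * t₁ * t₂) ⊗ va≡Bg ⊞ (a * v * t₂) ⊗ K₁-def
        ⊞ (c * t₂ - u * t₂) ⊗ K₂-def ⊞ (- (t₂ * t₄)) ⊗ norm) (solve vars)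
    ; commute₂₁ = cancel-certificate gc ((c * t₃ * K₂ - c * t₃ * t₄) ⊗ u-c≡Ag
        ⊞ (c * t₁ * t₃ - c * t₃ * K₁) ⊗ va≡Bg ⊞ (- (a * v * t₃)) ⊗ K₁-def
        ⊞ (u * t₃ - c * t₃) ⊗ K₂-def ⊞ (t₃ * t₄) ⊗ norm) (solve vars)
    ; commute₂₂ = solve vars
    }
    where
    vars : List ℤ
    vars = a ∷ b ∷ c ∷ u ∷ v ∷ t₁ ∷ t₂ ∷ t₃ ∷ t₄ ∷ A ∷ B ∷ g ∷ K₁ ∷ K₂ ∷ []
    g² : g * g ≢ + 0
    g² = *-≢0 g≢0 g≢0
    gc : g * c ≢ + 0
    gc = *-≢0 g≢0 c≢0

  quadratic-condition : ∀ u v x₁ y₁ t₂ t₃ A B g {x₂ x₃ y₂ y₃} →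
    a * (x₁ * x₁ + x₂ * x₃) + b * (y₁ * y₁ + y₂ * y₃) ≡ c * + 1 →
    u * u + v * v * (a * b) ≡ c * c → u - c ≡ A * g → v * a ≡ B * g →
    x₂ ≡ A * t₂ → x₃ ≡ A * t₃ → y₂ ≡ B * t₂ → y₃ ≡ B * t₃ →
    g * g * (a * x₁ * x₁ + b * y₁ * y₁ - c) + + 2 * a * c * t₂ * t₃ * (c - u) ≡ + 0
  quadratic-condition u v x₁ y₁ t₂ t₃ A B g square₁₁ norm u-c≡Ag va≡Bg refl refl refl refl =
    by-certificate ((g * g) ⊗ square₁₁ ⊞ (a * t₂ * t₃ * ((u - c) + A * g)) ⊗ u-c≡Ag
      ⊞ (b * t₂ * t₃ * (v * a + B * g)) ⊗ va≡Bg ⊞ (- (a * t₂ * t₃)) ⊗ norm)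
      (solve (a ∷ b ∷ c ∷ u ∷ v ∷ x₁ ∷ y₁ ∷ t₂ ∷ t₃ ∷ A ∷ B ∷ g ∷ []))

  module ScalarX (b≢0 : b ≢ + 0) (t y₁ y₂ y₃ y₄ : ℤ)
    (E : Entrywise t (+ 0) (+ 0) t y₁ y₂ y₃ y₄) where
    open Entrywise E

    private
      vars : List ℤ
      vars = a ∷ b ∷ c ∷ t ∷ y₁ ∷ y₂ ∷ y₃ ∷ y₄ ∷ []

    traceless-Y : y₁ + y₄ ≡ + 0 → ScalarTraceless (scal t) (mat y₁ y₂ y₃ y₄)
    traceless-Y trace≡0 = t , y₂ , y₃ , y₁ , refl ,
      cong (mat y₁ y₂ y₃) (by-certificate (+ 1 ⊗ trace≡0) (solve vars)) ,
      by-certificate (+ 1 ⊗ square₁₁) (solve vars)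

    scalar-Y : y₁ + y₄ ≢ + 0 → ScalarPair (scal t) (mat y₁ y₂ y₃ y₄)
    scalar-Y trace≢0 = t , y₁ , refl , mat-cong refl y₂≡0 y₃≡0 (sym y₁≡y₄) ,
      by-certificate (+ 1 ⊗ square₁₁ ⊞ (- (b * y₃)) ⊗ y₂≡0) (solve vars)
      where
      b*[z*trace]≡0⇒z≡0 : ∀ {z} → b * (z * (y₁ + y₄)) ≡ + 0 → z ≡ + 0
      b*[z*trace]≡0⇒z≡0 = i*j≡0⇒i≡0 trace≢0 ∘ i*j≡0⇒j≡0 b≢0
      y₂≡0 : y₂ ≡ + 0
      y₂≡0 = b*[z*trace]≡0⇒z≡0 (by-certificate (+ 1 ⊗ square₁₂) (solve vars))
      y₃≡0 : y₃ ≡ + 0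
      y₃≡0 = b*[z*trace]≡0⇒z≡0 (by-certificate (+ 1 ⊗ square₂₁) (solve vars))
      y₁≡y₄ : y₁ ≡ y₄
      y₁≡y₄ = i-j≡0⇒i≡j y₁ y₄ (b*[z*trace]≡0⇒z≡0
        (by-certificate (+ 1 ⊗ square₁₁ ⊞ (- + 1) ⊗ square₂₂) (solve vars)))

    solution : ScalarPair (scal t) (mat y₁ y₂ y₃ y₄)
             ⊎ ScalarTraceless (scal t) (mat y₁ y₂ y₃ y₄)
    solution with y₁ + y₄ ≟ + 0
    ... | yes trace≡0 = inj₂ (traceless-Y trace≡0)
    ... | no trace≢0 = inj₁ (scalar-Y trace≢0)

  module NonScalarX (a≢0 : a ≢ + 0) (b≢0 : b ≢ + 0) (c≢0 : c ≢ + 0)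
    (x₁ x₂ x₃ x₄ y₁ y₂ y₃ y₄ : ℤ) (E : Entrywise x₁ x₂ x₃ x₄ y₁ y₂ y₃ y₄)
    (X-nonscalar : ¬ (x₂ ≡ + 0 × x₃ ≡ + 0 × x₁ ≡ x₄))
    {u v : ℤ} (u-def : u ≡ a * (x₁ * x₄ - x₂ * x₃) - b * (y₁ * y₄ - y₂ * y₃))
    (v-def : v ≡ x₁ * y₄ + x₄ * y₁ - + 2 * x₂ * y₃)
    where
    open Entrywise E

    private
      vars : List ℤ
      vars = a ∷ b ∷ c ∷ x₁ ∷ x₂ ∷ x₃ ∷ x₄ ∷ y₁ ∷ y₂ ∷ y₃ ∷ y₄ ∷ u ∷ v ∷ []

    c*x₄≡u*x₁+v*b*y₁ : c * x₄ ≡ u * x₁ + v * b * y₁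
    c*x₄≡u*x₁+v*b*y₁ = by-certificate
      ((- x₄) ⊗ square₁₁ ⊞ x₂ ⊗ square₂₁ ⊞ (- (b * y₃)) ⊗ commute₁₂
        ⊞ (- x₁) ⊗ u-def ⊞ (- (b * y₁)) ⊗ v-def) (solve vars)

    c*y₄≡v*a*x₁-u*y₁ : c * y₄ ≡ v * a * x₁ - u * y₁
    c*y₄≡v*a*x₁-u*y₁ = by-certificate
      ((- y₄) ⊗ square₁₁ ⊞ (+ 2 * y₃) ⊗ square₁₂ ⊞ (- y₂) ⊗ square₂₁
        ⊞ (- (+ 2 * a * x₄)) ⊗ commute₁₁ ⊞ (a * x₃) ⊗ commute₁₂
        ⊞ y₁ ⊗ u-def ⊞ (- (a * x₁)) ⊗ v-def) (solve vars)

    u*u+v*v*ab≡c*c : u * u + v * v * (a * b) ≡ c * c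
    u*u+v*v*ab≡c*c = by-certificate
      ((b * y₄ * y₄ + a * x₄ * x₄) ⊗ square₁₁ ⊞ (- (+ 4 * b * y₃ * y₄)) ⊗ square₁₂
        ⊞ (+ 2 * b * y₂ * y₄ - + 2 * a * x₂ * x₄) ⊗ square₂₁
        ⊞ (c + b * y₂ * y₃ + a * x₂ * x₃) ⊗ square₂₂
        ⊞ (+ 4 * a * b * x₄ * y₄ + + 4 * a * b * x₂ * y₃) ⊗ commute₁₁
        ⊞ (+ 2 * a * b * x₄ * y₃ - + 2 * a * b * x₃ * y₄) ⊗ commute₁₂
        ⊞ (u + a * (x₁ * x₄ - x₂ * x₃) - b * (y₁ * y₄ - y₂ * y₃)) ⊗ u-def
        ⊞ (a * b * (v + x₁ * y₄ + x₄ * y₁ - + 2 * x₂ * y₃)) ⊗ v-def) (solve vars)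

    [u-c]*y₂≡v*a*x₂ : (u - c) * y₂ ≡ v * a * x₂
    [u-c]*y₂≡v*a*x₂ = by-certificate
      ((- y₄) ⊗ square₁₂ ⊞ y₂ ⊗ square₂₂ ⊞ (+ 2 * a * x₂) ⊗ commute₁₁
        ⊞ (a * x₄) ⊗ commute₁₂ ⊞ y₂ ⊗ u-def ⊞ (- (a * x₂)) ⊗ v-def) (solve vars)

    [u-c]*y₃≡v*a*x₃ : (u - c) * y₃ ≡ v * a * x₃
    [u-c]*y₃≡v*a*x₃ = by-certificate
      ((- y₄) ⊗ square₂₁ ⊞ y₃ ⊗ square₂₂ ⊞ (- (a * x₄)) ⊗ commute₂₁
        ⊞ y₃ ⊗ u-def ⊞ (- (a * x₃)) ⊗ v-def) (solve vars)

    2ac*x₂*x₂≡[ax₂x₂+by₂y₂]*[c-u] :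
      + 2 * a * c * x₂ * x₂ ≡ (a * x₂ * x₂ + b * y₂ * y₂) * (c - u)
    2ac*x₂*x₂≡[ax₂x₂+by₂y₂]*[c-u] = by-certificate
      ((a * x₂ * x₄ - b * y₂ * y₄) ⊗ square₁₂ ⊞ (b * y₂ * y₂ - a * x₂ * x₂) ⊗ square₂₂
        ⊞ (+ 2 * a * b * x₂ * y₂) ⊗ commute₁₁ ⊞ (a * b * x₄ * y₂ + a * b * x₂ * y₄) ⊗ commute₁₂
        ⊞ (a * x₂ * x₂ + b * y₂ * y₂) ⊗ u-def) (solve vars)

    2ac*x₃*x₃≡[ax₃x₃+by₃y₃]*[c-u] :
      + 2 * a * c * x₃ * x₃ ≡ (a * x₃ * x₃ + b * y₃ * y₃) * (c - u)
    2ac*x₃*x₃≡[ax₃x₃+by₃y₃]*[c-u] = by-certificate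
      ((a * x₃ * x₄ - b * y₃ * y₄) ⊗ square₂₁ ⊞ (b * y₃ * y₃ - a * x₃ * x₃) ⊗ square₂₂
        ⊞ (- (+ 2 * a * b * x₃ * y₃)) ⊗ commute₁₁
        ⊞ (- (a * b * x₄ * y₃) - a * b * x₃ * y₄) ⊗ commute₂₁
        ⊞ (a * x₃ * x₃ + b * y₃ * y₃) ⊗ u-def) (solve vars)

    2ac≢0 : + 2 * a * c ≢ + 0
    2ac≢0 = *-≢0 {+ 2 * a} (*-≢0 {+ 2} (λ ()) a≢0) c≢0

    u≡c⇒x₂≡0 : u ≡ c → x₂ ≡ + 0
    u≡c⇒x₂≡0 u≡c = k*x*x≡0⇒x≡0 2ac≢0
      (trans 2ac*x₂*x₂≡[ax₂x₂+by₂y₂]*[c-u] ((a * x₂ * x₂ + b * y₂ * y₂) ⊗ sym u≡c))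

    u≡c⇒x₃≡0 : u ≡ c → x₃ ≡ + 0
    u≡c⇒x₃≡0 u≡c = k*x*x≡0⇒x≡0 2ac≢0
      (trans 2ac*x₃*x₃≡[ax₃x₃+by₃y₃]*[c-u] ((a * x₃ * x₃ + b * y₃ * y₃) ⊗ sym u≡c))

    u≡c⇒v≡0 : u ≡ c → v ≡ + 0
    u≡c⇒v≡0 u≡c = k*x*x≡0⇒x≡0 (*-≢0 a≢0 b≢0)
      (by-certificate (+ 1 ⊗ u*u+v*v*ab≡c*c ⊞ (- (u + c)) ⊗ u≡c) (solve vars))

    u≡c⇒x₁≡x₄ : u ≡ c → x₁ ≡ x₄
    u≡c⇒x₁≡x₄ u≡c = cancel-certificate c≢0 ((- + 1) ⊗ c*x₄≡u*x₁+v*b*y₁ ⊞ (- x₁) ⊗ u≡c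
      ⊞ (- (b * y₁)) ⊗ u≡c⇒v≡0 u≡c) (solve vars)

    u≢c : u ≢ c
    u≢c u≡c = X-nonscalar (u≡c⇒x₂≡0 u≡c , u≡c⇒x₃≡0 u≡c , u≡c⇒x₁≡x₄ u≡c)

    u-c≢0 : u - c ≢ + 0
    u-c≢0 = u≢c ∘ i-j≡0⇒i≡j u c

    solution : ParametricPair (mat x₁ x₂ x₃ x₄) (mat y₁ y₂ y₃ y₄)
    solution =
      let t₂ , x₂≡At₂ , y₂≡Bt₂ = gcd-proportional (v * a) u-c≢0 [u-c]*y₂≡v*a*x₂
          t₃ , x₃≡At₃ , y₃≡Bt₃ = gcd-proportional (v * a) u-c≢0 [u-c]*y₃≡v*a*x₃
          g = gcd (v * a) (u - c)
      in
      x₁ , t₂ , t₃ , y₁ , u , v , u≢c , u*u+v*v*ab≡c*c ,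
      quadratic-condition u v x₁ y₁ t₂ t₃ ((u - c) ÷ g) ((v * a) ÷ g) g
        square₁₁ u*u+v*v*ab≡c*c (j≡[j÷gcd]*gcd (v * a) u-c≢0) (i≡[i÷gcd]*gcd (v * a) u-c≢0)
        x₂≡At₂ x₃≡At₃ y₂≡Bt₂ y₃≡Bt₃ ,
      d*q≡n⇒d∣n c x₄ c*x₄≡u*x₁+v*b*y₁ , d*q≡n⇒d∣n c y₄ c*y₄≡v*a*x₁-u*y₁ ,
      mat-cong refl x₂≡At₂ x₃≡At₃ (d*q≡n⇒q≡n÷d x₄ c≢0 c*x₄≡u*x₁+v*b*y₁) ,
      mat-cong refl y₂≡Bt₂ y₃≡Bt₃ (d*q≡n⇒q≡n÷d y₄ c≢0 c*y₄≡v*a*x₁-u*y₁)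

  classify : a ≢ + 0 → b ≢ + 0 → c ≢ + 0 → ∀ X Y → Solves X Y → Classified X Y
  classify a≢0 b≢0 c≢0 (mat x₁ x₂ x₃ x₄) (mat y₁ y₂ y₃ y₄) S
    with x₂ ≟ + 0 ×-dec x₃ ≟ + 0 ×-dec x₁ ≟ x₄
  ... | yes (refl , refl , refl) = map₂ inj₁ (ScalarX.solution b≢0 x₁ y₁ y₂ y₃ y₄
    (Equivalence.to (Solves⇔Entrywise x₁ (+ 0) (+ 0) x₁ y₁ y₂ y₃ y₄) S))
  ... | no X-nonscalar = inj₂ (inj₂ (NonScalarX.solution a≢0 b≢0 c≢0 x₁ x₂ x₃ x₄ y₁ y₂ y₃ y₄
    (Equivalence.to (Solves⇔Entrywise x₁ x₂ x₃ x₄ y₁ y₂ y₃ y₄) S) X-nonscalar refl refl))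

  classified⇒solves : c ≢ + 0 → ∀ X Y → Classified X Y → Solves X Y
  classified⇒solves _ _ _ (inj₁ (t₁ , t₂ , refl , refl , eq)) =
    Equivalence.from (Solves⇔Entrywise t₁ (+ 0) (+ 0) t₁ t₂ (+ 0) (+ 0) t₂)
      (scalar-pair-solves t₁ t₂ eq)
  classified⇒solves _ _ _ (inj₂ (inj₁ (t₁ , t₂ , t₃ , t₄ , refl , refl , eq))) =
    Equivalence.from (Solves⇔Entrywise t₁ (+ 0) (+ 0) t₁ t₄ t₂ t₃ (- t₄))
      (scalar-traceless-solves t₁ t₂ t₃ t₄ eq)
  classified⇒solves c≢0 _ _ (inj₂ (inj₂
    (t₁ , t₂ , t₃ , t₄ , u , v , u≢c , norm , quad , c∣K₁ , c∣K₂ , refl , refl))) =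
    Equivalence.from (Solves⇔Entrywise t₁ (A * t₂) (A * t₃) K₁ t₄ (B * t₂) (B * t₃) K₂)
      (parametric-solves u v t₁ t₂ t₃ t₄ A B g K₁ K₂ c≢0 (gcd≢0 (v * a) u-c≢0) norm quad
        (j≡[j÷gcd]*gcd (v * a) u-c≢0) (i≡[i÷gcd]*gcd (v * a) u-c≢0)
        (n≡[n÷d]*d c c≢0 c∣K₁) (n≡[n÷d]*d c c≢0 c∣K₂))
    where
    g A B K₁ K₂ : ℤ
    g = gcd (v * a) (u - c)
    A = (u - c) ÷ g
    B = (v * a) ÷ g
    K₁ = (u * t₁ + v * b * t₄) ÷ c
    K₂ = (v * a * t₁ - u * t₄) ÷ c
    u-c≢0 : u - c ≢ + 0
    u-c≢0 = u≢c ∘ i-j≡0⇒i≡j u c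

theorem4p2 : (a b c : ℤ) → a ≢ + 0 → b ≢ + 0 → c ≢ + 0 →
    ¬ (∃ λ k → k * k ≡ - (a * b)) →
    gcd (gcd a b) c ≡ + 1 →
    (X Y : M₂) →
    ((((a ⊙ (X · X)) ⊕ (b ⊙ (Y · Y))) ≡ c ⊙ I₂) × (X · Y ≡ Y · X))
    ⇔
    ((∃ λ t₁ → ∃ λ t₂ → X ≡ scal t₁ × Y ≡ scal t₂
        × a * t₁ * t₁ + b * t₂ * t₂ ≡ c)
    ⊎ (∃ λ t₁ → ∃ λ t₂ → ∃ λ t₃ → ∃ λ t₄ →
        X ≡ scal t₁ × Y ≡ mat t₄ t₂ t₃ (- t₄)
        × a * t₁ * t₁ + b * (t₄ * t₄ + t₂ * t₃) ≡ c)
    ⊎ (∃ λ t₁ → ∃ λ t₂ → ∃ λ t₃ → ∃ λ t₄ → ∃ λ u → ∃ λ v →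
        let g = gcd (v * a) (u - c) in
        u ≢ c
        × u * u + v * v * (a * b) ≡ c * c
        × g * g * (a * t₁ * t₁ + b * t₄ * t₄ - c)
            + + 2 * a * c * t₂ * t₃ * (c - u) ≡ + 0
        × c ∣ (u * t₁ + v * b * t₄)
        × c ∣ (v * a * t₁ - u * t₄)
        × X ≡ mat t₁ (((u - c) ÷ g) * t₂) (((u - c) ÷ g) * t₃)
                  ((u * t₁ + v * b * t₄) ÷ c)
        × Y ≡ mat t₄ (((v * a) ÷ g) * t₂) (((v * a) ÷ g) * t₃)
                  ((v * a * t₁ - u * t₄) ÷ c)))
theorem4p2 a b c a≢0 b≢0 c≢0 _ _ X Y =
  mk⇔ (classify a b c a≢0 b≢0 c≢0 X Y) (classified⇒solves a b c c≢0 X Y)
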